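{- Let $F_{12}$ be the graph on vertices $u,x,y,z,w$ with edge set $\{ux,uy,uz,xy,yz,uw\}$ and $F_{13}$ the graph on vertices $u,v,x,y,z$ with edge set $\{ux,uy,vx,vy,xy,uz\}$. For every integer $k\geq 1$ and every $H\in\{F_{12},F_{13}\}$, $$gr_k(K_3 : H)> \begin{cases} 9\cdot 5^{(k-2)/2}, & \text{if } k \text{ is even},\\ 4\cdot 5^{(k-1)/2}, & \text{if } k \text{ is odd}.\end{cases}$$
   Context: A $k$-coloring of a graph is an assignment of one of $k$ colors to each edge (not necessarily proper). A subgraph is monochromatic if all its edges have the same color and rainbow if all its edges have distinct colors. For graphs $G$ and $H$, the $k$-colored Gallai-Ramsey number $gr_k(G : H)$ is the minimum integer $N$ such that every $k$-coloring of the edges of $K_N$ contains either a rainbow copy of $G$ or a monochromatic copy of $H$ (copies are subgraphs, not necessarily induced). Here $K_3$ is the triangle. -}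

module Defs where

open import Data.Nat using (ℕ; zero; suc; _*_; _^_; _∸_; _≤_; _/_; _%_)
open import Data.Fin using (Fin; #_)
open import Data.Product using (_×_; _,_; Σ; ∃)
open import Data.Sum using (_⊎_)
open import Data.List using (List; []; _∷_; map)
open import Data.List.Relation.Unary.All using (All)
open import Data.List.Relation.Unary.Unique.Propositional using (Unique)
open import Function.Definitions using (Injective)
open import Relation.Binary.PropositionalEquality using (_≡_)
open import Relation.Nullary using (¬_)

Graph : ℕ → Set
Graph m = List (Fin m × Fin m)

-- A k-coloring of the edges of K_N: each unordered pair {i,j} (i ≠ j)
-- receives one of k colors; we represent it by a symmetric function.
-- (Values c i i are irrelevant: embeddings are injective, so never used.)
record Coloring (k N : ℕ) : Set where
  field
    col : Fin N → Fin N → Fin k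
    sym : ∀ i j → col i j ≡ col j i
open Coloring public

Embedding : ℕ → ℕ → Set
Embedding m N = Σ (Fin m → Fin N) λ f → Injective _≡_ _≡_ f

edgeColors : ∀ {k N m} → Coloring k N → (Fin m → Fin N) → Graph m → List (Fin k)
edgeColors c f G = map (λ e → col c (f (Data.Product.proj₁ e)) (f (Data.Product.proj₂ e))) G

HasRainbow : ∀ {k N m} → Coloring k N → Graph m → Set
HasRainbow {N = N} {m = m} c G =
  Σ (Embedding m N) λ emb → Unique (edgeColors c (Data.Product.proj₁ emb) G)

HasMono : ∀ {k N m} → Coloring k N → Graph m → Set
HasMono {k = k} {N = N} {m = m} c G =
  Σ (Embedding m N) λ emb → Σ (Fin k) λ a → All (_≡ a) (edgeColors c (Data.Product.proj₁ emb) G)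

GRArrows : ∀ {m m'} → (k : ℕ) → Graph m → Graph m' → ℕ → Set
GRArrows k G H N = (c : Coloring k N) → HasRainbow c G ⊎ HasMono c H

-- gr_k(G : H) > B : no N ≤ B has the arrowing property
-- (so the least such N, if any, exceeds B).
GRGreater : ∀ {m m'} → (k : ℕ) → Graph m → Graph m' → ℕ → Set
GRGreater k G H B = ∀ N → N ≤ B → ¬ GRArrows k G H N

K3 : Graph 3
K3 = (# 0 , # 1) ∷ (# 1 , # 2) ∷ (# 0 , # 2) ∷ []

-- F12: u=0, x=1, y=2, z=3, w=4 ; edges ux, uy, uz, xy, yz, uw
F12 : Graph 5
F12 = (# 0 , # 1) ∷ (# 0 , # 2) ∷ (# 0 , # 3) ∷ (# 1 , # 2) ∷ (# 2 , # 3) ∷ (# 0 , # 4) ∷ []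

-- F13: u=0, v=1, x=2, y=3, z=4 ; edges ux, uy, vx, vy, xy, uz
F13 : Graph 5
F13 = (# 0 , # 2) ∷ (# 0 , # 3) ∷ (# 1 , # 2) ∷ (# 1 , # 3) ∷ (# 2 , # 3) ∷ (# 0 , # 4) ∷ []

grBound : ℕ → ℕ
grBound k with k % 2
... | zero = 9 * 5 ^ ((k ∸ 2) / 2)
... | suc _ = 4 * 5 ^ ((k ∸ 1) / 2)

module Submission where

-- Call an edge colouring of the complete graph on a vertex type V *good* for H when
-- it is symmetric, has no rainbow triangle and no monochromatic copy of H.  A good
-- k-colouring of a set containing N points shows gr_k(K3 : H) > N.
--
-- The only properties of H = F12, F13 that are used: H is connected and contains a
-- diamond (K4 minus an edge), hence a triangle.  The construction:
--   * one colour on 4 vertices is good for any 5-vertex H (there is no copy at all);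
--   * the rook colouring of the 3x3 grid (same row or column vs. not) is a good
--     2-colouring for every H containing a diamond, as it has no monochromatic diamond;
--   * substitution: if an r-colouring of O has neither rainbow nor monochromatic
--     triangles, replacing every vertex of O by a copy of a good k-colouring (edges
--     between blocks keep their outer colour, the k inner colours are new) gives a good
--     (r+k)-colouring, provided H is connected and contains a triangle;
--   * the pentagon colouring of K5 (5-cycle vs. its complement) is such an outer
--     2-colouring, so each substitution multiplies the size by 5 and adds 2 colours.
-- Starting from 4 vertices (k odd) or 9 vertices (k even) yields exactly grBound k.

open import Defs hiding (sym)
open import Data.Nat using (ℕ; _≤_)
open import Data.Sum using (_⊎_)
open import Relation.Binary.PropositionalEquality using (_≡_)

open import Data.Nat using (zero; suc; _+_; _*_; _^_; _<_; _%_; _/_)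
open import Data.Nat.Properties using (*-assoc; *-comm; +-comm; *-identityˡ; n<1+n)
open import Data.Nat.DivMod using ([m+kn]%n≡m%n; m*n/n≡m)
open import Data.Fin using (Fin; suc; _≟_; _↑ˡ_; _↑ʳ_; inject₁; inject≤)
open import Data.Fin.Patterns using (0F; 1F; 2F; 3F; 4F)
open import Data.Fin.Properties
  using (all?; pigeonhole; <⇒≢; suc-injective; ↑ʳ-injective; ↑ˡ-injective; inject₁-injective; inject≤-injective; *↔×)
open import Data.Product using (_×_; _,_; Σ; ∃; proj₁; proj₂)
open import Data.Product.Properties using (≡-dec; ×-≡,≡→≡)
open import Data.Product.Function.NonDependent.Propositional using (_×-↣_)
open import Data.Sum using (inj₁; inj₂; [_,_]′; swap)
open import Data.List using (List; []; _∷_; map)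
open import Data.List.Membership.Propositional using (_∈_)
open import Data.List.Relation.Unary.Any using (here; there)
open import Data.List.Relation.Unary.All using (All; []; _∷_; lookup)
import Data.List.Relation.Unary.All as All
import Data.List.Relation.Unary.All.Properties as All
open import Data.List.Relation.Unary.AllPairs using ([]; _∷_)
open import Data.List.Relation.Unary.Unique.Propositional using (Unique)
import Data.List.Relation.Unary.Unique.Propositional.Properties as Unique
open import Data.Bool using (_∨_; if_then_else_)
open import Data.Bool.Properties using (∨-comm)
open import Data.Empty using (⊥; ⊥-elim)
open import Function using (_∘_)
open import Function.Bundles using (Injection; _↣_; mk↣)
open import Function.Construct.Composition using (_↣-∘_)
open import Function.Construct.Identity using (↣-id)
open import Function.Definitions using (Injective)
open import Function.Properties.Inverse using (↔⇒↣)
open import Relation.Binary.Definitions using (DecidableEquality)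
open import Relation.Binary.PropositionalEquality using (_≢_; refl; sym; trans; cong; cong₂; subst; subst₂)
open import Relation.Nullary using (¬_; Dec; yes; no; does; ¬?; map′)
open import Relation.Nullary.Decidable using (toWitness; _→-dec_)

colours : ∀ {k m} {V : Set} → (V → V → Fin k) → (Fin m → V) → Graph m → List (Fin k)
colours c f G = map (λ e → c (f (proj₁ e)) (f (proj₂ e))) G

Rainbow : ∀ {k m} {V : Set} → (V → V → Fin k) → (Fin m → V) → Graph m → Set
Rainbow c f G = Unique (colours c f G)

Mono : ∀ {k m} {V : Set} → (V → V → Fin k) → (Fin m → V) → Graph m → Fin k → Set
Mono c f G j = All (_≡ j) (colours c f G)

record Good (k : ℕ) (V : Set) {m : ℕ} (H : Graph m) : Set where
  field
    colour            : V → V → Fin k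
    symmetric         : ∀ x y → colour x y ≡ colour y x
    noRainbowTriangle : (f : Fin 3 → V) → Injective _≡_ _≡_ f → ¬ Rainbow colour f K3
    noMonoCopy        : (f : Fin m → V) → Injective _≡_ _≡_ f → ∀ j → ¬ Mono colour f H j

distinct : ∀ {n} {A : Set} {f : Fin n → A} → Injective _≡_ _≡_ f → ∀ i j → i ≢ j → f i ≢ f j
distinct f-inj i j i≢j = i≢j ∘ f-inj

distinct⇒injective : ∀ {A : Set} (g : Fin 3 → A) →
  g 0F ≢ g 1F → g 1F ≢ g 2F → g 0F ≢ g 2F → Injective _≡_ _≡_ g
distinct⇒injective g n01 n12 n02 {0F} {0F} _ = refl
distinct⇒injective g n01 n12 n02 {0F} {1F} e = ⊥-elim (n01 e)
distinct⇒injective g n01 n12 n02 {0F} {2F} e = ⊥-elim (n02 e)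
distinct⇒injective g n01 n12 n02 {1F} {0F} e = ⊥-elim (n01 (sym e))
distinct⇒injective g n01 n12 n02 {1F} {1F} _ = refl
distinct⇒injective g n01 n12 n02 {1F} {2F} e = ⊥-elim (n12 e)
distinct⇒injective g n01 n12 n02 {2F} {0F} e = ⊥-elim (n02 (sym e))
distinct⇒injective g n01 n12 n02 {2F} {1F} e = ⊥-elim (n12 (sym e))
distinct⇒injective g n01 n12 n02 {2F} {2F} _ = refl

pullBack : ∀ {k N m} {V : Set} {H : Graph m} → Good k V H → Fin N ↣ V → Coloring k N
pullBack G ι = record { col = λ i j → colour (to i) (to j) ; sym = λ i j → symmetric (to i) (to j) }
  where open Good G
        open Injection ι

good⇒¬arrows : ∀ {k N m} {V : Set} {H : Graph m} → Good k V H → Fin N ↣ V → ¬ GRArrows k K3 H N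
good⇒¬arrows {H = H} G ι arrows = [ rainbowCase , monoCase ]′ (arrows (pullBack G ι))
  where
    open Good G
    open Injection ι
    rainbowCase : HasRainbow (pullBack G ι) K3 → ⊥
    rainbowCase ((f , f-inj) , rainbow) = noRainbowTriangle (to ∘ f) (λ e → f-inj (injective e)) rainbow
    monoCase : HasMono (pullBack G ι) H → ⊥
    monoCase ((f , f-inj) , j , mono) = noMonoCopy (to ∘ f) (λ e → f-inj (injective e)) j mono

≤⇒↣ : ∀ {m n} → m ≤ n → Fin m ↣ Fin n
≤⇒↣ m≤n = mk↣ {to = λ i → inject≤ i m≤n} (λ {i} {j} → inject≤-injective m≤n m≤n i j)

good⇒GRGreater : ∀ {k B m} {V : Set} {H : Graph m} → Good k V H → Fin B ↣ V → GRGreater k K3 H B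
good⇒GRGreater G ι N N≤B = good⇒¬arrows G (ι ↣-∘ ≤⇒↣ N≤B)

_∈ₑ_ : ∀ {m} → Fin m × Fin m → Graph m → Set
(x , y) ∈ₑ H = (x , y) ∈ H ⊎ (y , x) ∈ H

_⊆_ : ∀ {m' m} → Graph m' → Graph m → Set
_⊆_ {m'} {m} G H =
  Σ (Fin m' → Fin m) λ t → Injective _≡_ _≡_ t × All (λ e → (t (proj₁ e) , t (proj₂ e)) ∈ₑ H) G

⊆-trans : ∀ {m'' m' m} {G : Graph m''} {H' : Graph m'} {H : Graph m} → G ⊆ H' → H' ⊆ H → G ⊆ H
⊆-trans {H' = H'} {H} (t , t-inj , t-edges) (s , s-inj , s-edges) =
  s ∘ t , (λ e → t-inj (s-inj e)) , All.map mapEdge t-edges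
  where
    mapEdge : ∀ {x y} → (x , y) ∈ₑ H' → (s x , s y) ∈ₑ H
    mapEdge (inj₁ xy∈H') = lookup s-edges xy∈H'
    mapEdge (inj₂ yx∈H') = swap (lookup s-edges yx∈H')

edgeColour : ∀ {k m} {V : Set} {c : V → V → Fin k} {f : Fin m → V} {H : Graph m} {j x y} →
  (∀ v w → c v w ≡ c w v) → Mono c f H j → (x , y) ∈ₑ H → c (f x) (f y) ≡ j
edgeColour c-sym mono (inj₁ xy∈H) = lookup (All.map⁻ mono) xy∈H
edgeColour c-sym mono (inj₂ yx∈H) = trans (c-sym _ _) (lookup (All.map⁻ mono) yx∈H)

mono-⊆ : ∀ {k m' m} {V : Set} {c : V → V → Fin k} {f : Fin m → V} {G : Graph m'} {H : Graph m} {j} →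
  (∀ v w → c v w ≡ c w v) → (G⊆H : G ⊆ H) → Mono c f H j → Mono c (f ∘ proj₁ G⊆H) G j
mono-⊆ c-sym (t , _ , edges) mono = All.map⁺ (All.map (edgeColour c-sym mono) edges)

Connected : ∀ {m} → Graph m → Set₁
Connected {m} H = ∀ {O : Set} (g : Fin m → O) → All (λ e → g (proj₁ e) ≡ g (proj₂ e)) H → ∀ i j → g i ≡ g j

constantVia : ∀ {m} {O : Set} {g : Fin m → O} r → (∀ i → g i ≡ g r) → ∀ i j → g i ≡ g j
constantVia r toRoot i j = trans (toRoot i) (sym (toRoot j))

Diamond : Graph 4
Diamond = (0F , 1F) ∷ (0F , 2F) ∷ (1F , 2F) ∷ (0F , 3F) ∷ (2F , 3F) ∷ []

K3⊆Diamond : K3 ⊆ Diamond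
K3⊆Diamond = inject₁ , inject₁-injective ,
  inj₁ (here refl) ∷ inj₁ (there (there (here refl))) ∷ inj₁ (there (here refl)) ∷ []

-- u x y z ↦ u x y z: the triangles uxy and uyz share uy.
Diamond⊆F12 : Diamond ⊆ F12
Diamond⊆F12 = inject₁ , inject₁-injective ,
  inj₁ (here refl) ∷ inj₁ (there (here refl)) ∷ inj₁ (there (there (there (here refl))))
  ∷ inj₁ (there (there (here refl))) ∷ inj₁ (there (there (there (there (here refl))))) ∷ []

-- x u y v: the triangles xuy and xyv share xy.
Diamond⊆F13 : Diamond ⊆ F13
Diamond⊆F13 = t , (λ {i} {j} e → trans (sym (back-t i)) (trans (cong back e) (back-t j))) ,
  inj₂ (here refl) ∷ inj₁ (there (there (there (there (here refl))))) ∷ inj₁ (there (here refl))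
  ∷ inj₂ (there (there (here refl))) ∷ inj₂ (there (there (there (here refl)))) ∷ []
  where
    t : Fin 4 → Fin 5
    t 0F = 2F
    t 1F = 0F
    t 2F = 3F
    t 3F = 1F
    back : Fin 5 → Fin 4
    back 0F = 1F
    back 1F = 3F
    back 2F = 0F
    back 3F = 2F
    back 4F = 0F
    back-t : ∀ i → back (t i) ≡ i
    back-t 0F = refl
    back-t 1F = refl
    back-t 2F = refl
    back-t 3F = refl

F12-connected : Connected F12
F12-connected g (ux ∷ uy ∷ uz ∷ _ ∷ _ ∷ uw ∷ []) = constantVia 0F toU
  where
    toU : ∀ i → g i ≡ g 0F
    toU 0F = refl
    toU 1F = sym ux
    toU 2F = sym uy
    toU 3F = sym uz
    toU 4F = sym uw

-- Every vertex of F13 is joined to u, except v, which reaches u through x.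
F13-connected : Connected F13
F13-connected g (ux ∷ uy ∷ vx ∷ _ ∷ _ ∷ uz ∷ []) = constantVia 0F toU
  where
    toU : ∀ i → g i ≡ g 0F
    toU 0F = refl
    toU 1F = trans vx (sym ux)
    toU 2F = sym ux
    toU 3F = sym uy
    toU 4F = sym uz

twoColours-noRainbow : ∀ {V : Set} (c : V → V → Fin 2) (f : Fin 3 → V) → ¬ Rainbow c f K3
twoColours-noRainbow c f ((n01 ∷ n02 ∷ []) ∷ (n12 ∷ []) ∷ [] ∷ []) = noThreeDistinct _ _ _ n01 n02 n12
  where
    noThreeDistinct : (x y z : Fin 2) → x ≢ y → x ≢ z → y ≢ z → ⊥
    noThreeDistinct 0F 0F _  x≢y _   _   = x≢y refl
    noThreeDistinct 1F 1F _  x≢y _   _   = x≢y refl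
    noThreeDistinct 0F 1F 0F _   x≢z _   = x≢z refl
    noThreeDistinct 0F 1F 1F _   _   y≢z = y≢z refl
    noThreeDistinct 1F 0F 0F _   _   y≢z = y≢z refl
    noThreeDistinct 1F 0F 1F _   x≢z _   = x≢z refl

-- With fewer than m points there is no copy of an m-vertex graph, and one colour
-- never forms a rainbow triangle.
tooFewVertices : ∀ {n m} {H : Graph m} → n < m → Good 1 (Fin n) H
tooFewVertices n<m = record
  { colour = λ _ _ → 0F
  ; symmetric = λ _ _ → refl
  ; noRainbowTriangle = λ { f _ ((0≢0 ∷ _) ∷ _) → 0≢0 refl }
  ; noMonoCopy = λ f f-inj _ _ → noCopy f f-inj
  }
  where
    noCopy : ∀ f → Injective _≡_ _≡_ f → ⊥
    noCopy f f-inj with i , j , i<j , fi≡fj ← pigeonhole n<m f = <⇒≢ i<j (f-inj fi≡fj)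

Cell : Set
Cell = Fin 3 × Fin 3

_≟ᶜ_ : DecidableEquality Cell
_≟ᶜ_ = ≡-dec _≟_ _≟_

rook : Cell → Cell → Fin 2
rook (a , b) (a' , b') = if does (a ≟ a') ∨ does (b ≟ b') then 0F else 1F

allCells? : {P : Cell → Set} → (∀ p → Dec (P p)) → Dec (∀ p → P p)
allCells? P? = map′ (λ h (x , y) → h x y) (λ h x y → h (x , y)) (all? λ x → all? λ y → P? (x , y))

rook-sym : ∀ p q → rook p q ≡ rook q p
rook-sym = toWitness {a? = allCells? λ p → allCells? λ q → rook p q ≟ rook q p} _

-- The rook colouring has no monochromatic diamond (checked exhaustively): two
-- lines meeting in a,c cannot both contain a third point, and two transversals
-- through a,c coincide.
rook-noMonoDiamond : ∀ a b c d → a ≢ b → a ≢ c → a ≢ d → b ≢ c → b ≢ d → c ≢ d →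
  rook a b ≡ rook a c → rook a b ≡ rook b c → rook a b ≡ rook a d → rook a b ≢ rook c d
rook-noMonoDiamond = toWitness {a? = allCells? λ a → allCells? λ b → allCells? λ c → allCells? λ d →
  ¬? (a ≟ᶜ b) →-dec ¬? (a ≟ᶜ c) →-dec ¬? (a ≟ᶜ d) →-dec ¬? (b ≟ᶜ c) →-dec ¬? (b ≟ᶜ d) →-dec ¬? (c ≟ᶜ d) →-dec
  (rook a b ≟ rook a c) →-dec (rook a b ≟ rook b c) →-dec (rook a b ≟ rook a d) →-dec ¬? (rook a b ≟ rook c d)} _

rookGood : ∀ {m} {H : Graph m} → Diamond ⊆ H → Good 2 Cell H
rookGood D⊆H = record
  { colour = rook
  ; symmetric = rook-sym
  ; noRainbowTriangle = λ f _ → twoColours-noRainbow rook f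
  ; noMonoCopy = noMonoH
  }
  where
    noMonoDiamond : ∀ g → Injective _≡_ _≡_ g → ∀ j → ¬ Mono rook g Diamond j
    noMonoDiamond g g-inj j (ab ∷ ac ∷ bc ∷ ad ∷ cd ∷ []) =
      rook-noMonoDiamond (g 0F) (g 1F) (g 2F) (g 3F)
        (distinct g-inj 0F 1F λ ()) (distinct g-inj 0F 2F λ ()) (distinct g-inj 0F 3F λ ())
        (distinct g-inj 1F 2F λ ()) (distinct g-inj 1F 3F λ ()) (distinct g-inj 2F 3F λ ())
        (trans ab (sym ac)) (trans ab (sym bc)) (trans ab (sym ad)) (trans ab (sym cd))
    noMonoH : ∀ f → Injective _≡_ _≡_ f → ∀ j → ¬ Mono rook f _ j
    noMonoH f f-inj j mono =
      noMonoDiamond (f ∘ proj₁ D⊆H) (λ e → proj₁ (proj₂ D⊆H) (f-inj e)) j (mono-⊆ {f = f} rook-sym D⊆H mono)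

next : Fin 5 → Fin 5
next 0F = 1F
next 1F = 2F
next 2F = 3F
next 3F = 4F
next 4F = 0F

pentagon : Fin 5 → Fin 5 → Fin 2
pentagon a b = if does (next a ≟ b) ∨ does (next b ≟ a) then 0F else 1F

pentagon-sym : ∀ a b → pentagon a b ≡ pentagon b a
pentagon-sym a b = cong (if_then 0F else 1F) (∨-comm (does (next a ≟ b)) (does (next b ≟ a)))

pentagon-noMonoTriangle : ∀ a b c → a ≢ b → a ≢ c → b ≢ c →
  pentagon a b ≡ pentagon a c → pentagon a b ≢ pentagon b c
pentagon-noMonoTriangle = toWitness {a? = all? λ a → all? λ b → all? λ c →
  ¬? (a ≟ b) →-dec ¬? (a ≟ c) →-dec ¬? (b ≟ c) →-dec (pentagon a b ≟ pentagon a c) →-dec ¬? (pentagon a b ≟ pentagon b c)} _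

pentagonGood : Good 2 (Fin 5) K3
pentagonGood = record
  { colour = pentagon
  ; symmetric = pentagon-sym
  ; noRainbowTriangle = λ f _ → twoColours-noRainbow pentagon f
  ; noMonoCopy = λ { f f-inj j (ab ∷ bc ∷ ac ∷ []) →
      pentagon-noMonoTriangle (f 0F) (f 1F) (f 2F)
        (distinct f-inj 0F 1F λ ()) (distinct f-inj 0F 2F λ ()) (distinct f-inj 1F 2F λ ())
        (trans ab (sym ac)) (trans ab (sym bc)) }
  }

data Palette (r k : ℕ) : Fin (r + k) → Set where
  outerColour : (i : Fin r) → Palette r k (i ↑ˡ k)
  innerColour : (j : Fin k) → Palette r k (r ↑ʳ j)

palette : ∀ r {k} (x : Fin (r + k)) → Palette r k x
palette zero x = innerColour x
palette (suc r) 0F = outerColour 0F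
palette (suc r) (suc x) with palette r x
... | outerColour i = outerColour (suc i)
... | innerColour j = innerColour j

↑ˡ≢↑ʳ : ∀ {k} r (i : Fin r) (j : Fin k) → i ↑ˡ k ≢ r ↑ʳ j
↑ˡ≢↑ʳ (suc r) (suc i) j e = ↑ˡ≢↑ʳ r i j (suc-injective e)

module Substitution {r k m : ℕ} {O V : Set} {H : Graph m} (_≟ᴼ_ : DecidableEquality O)
  (outer : Good r O K3) (inner : Good k V H) (H-connected : Connected H) (K3⊆H : K3 ⊆ H) where

  open Good outer using () renaming (colour to oc; symmetric to oc-sym)
  open Good inner using () renaming (colour to c; symmetric to c-sym)

  block : O × V → O
  block = proj₁

  point : O × V → V
  point = proj₂

  blown : O × V → O × V → Fin (r + k)
  blown p q with block p ≟ᴼ block q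
  ... | yes _ = r ↑ʳ c (point p) (point q)
  ... | no _  = oc (block p) (block q) ↑ˡ k

  blown-inside : ∀ {p q} → block p ≡ block q → blown p q ≡ r ↑ʳ c (point p) (point q)
  blown-inside {p} {q} same with block p ≟ᴼ block q
  ... | yes _ = refl
  ... | no apart = ⊥-elim (apart same)

  blown-across : ∀ {p q} → block p ≢ block q → blown p q ≡ oc (block p) (block q) ↑ˡ k
  blown-across {p} {q} apart with block p ≟ᴼ block q
  ... | yes same = ⊥-elim (apart same)
  ... | no _ = refl

  blown-sym : ∀ p q → blown p q ≡ blown q p
  blown-sym p q with block p ≟ᴼ block q
  ... | yes same = trans (cong (r ↑ʳ_) (c-sym _ _)) (sym (blown-inside (sym same)))
  ... | no apart = trans (cong (_↑ˡ k) (oc-sym _ _)) (sym (blown-across (apart ∘ sym)))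

  blown-shared : ∀ {p q q'} → block q ≡ block q' → block p ≢ block q → blown p q ≡ blown p q'
  blown-shared {p} same apart =
    trans (blown-across apart)
      (trans (cong (λ b → oc (block p) b ↑ˡ k) same) (sym (blown-across (λ e → apart (trans e (sym same))))))

  inOneBlock : ∀ {n} (f : Fin n → O × V) → (∀ i j → block (f i) ≡ block (f j)) →
    (G : Graph n) → colours blown f G ≡ map (r ↑ʳ_) (colours c (point ∘ f) G)
  inOneBlock f same [] = refl
  inOneBlock f same (e ∷ G) = cong₂ _∷_ (blown-inside (same _ _)) (inOneBlock f same G)

  pointsInjective : ∀ {n} (f : Fin n → O × V) → (∀ i j → block (f i) ≡ block (f j)) →
    Injective _≡_ _≡_ f → Injective _≡_ _≡_ (point ∘ f)
  pointsInjective f same f-inj e = f-inj (×-≡,≡→≡ (same _ _ , e))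

  acrossBlocks : (f : Fin 3 → O × V) → block (f 0F) ≢ block (f 1F) → block (f 1F) ≢ block (f 2F) →
    block (f 0F) ≢ block (f 2F) → colours blown f K3 ≡ map (_↑ˡ k) (colours oc (block ∘ f) K3)
  acrossBlocks f n01 n12 n02 =
    cong₂ _∷_ (blown-across n01) (cong₂ _∷_ (blown-across n12) (cong₂ _∷_ (blown-across n02) refl))

  -- A rainbow triangle lies in one block (rainbow there), meets two blocks (two of
  -- its edges agree), or meets three blocks (rainbow in the outer colouring).
  noRainbow : (f : Fin 3 → O × V) → Injective _≡_ _≡_ f → ¬ Rainbow blown f K3
  noRainbow f f-inj rainbow@((c01≢c12 ∷ c01≢c02 ∷ []) ∷ (c12≢c02 ∷ []) ∷ [] ∷ []) =
    byBlocks (block (f 0F) ≟ᴼ block (f 1F)) (block (f 1F) ≟ᴼ block (f 2F)) (block (f 0F) ≟ᴼ block (f 2F))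
    where
      byBlocks : Dec (block (f 0F) ≡ block (f 1F)) → Dec (block (f 1F) ≡ block (f 2F)) →
                 Dec (block (f 0F) ≡ block (f 2F)) → ⊥
      byBlocks (yes e01) (yes e12) _ =
        Good.noRainbowTriangle inner (point ∘ f) (pointsInjective f same f-inj)
          (Unique.map⁻ {f = r ↑ʳ_} (subst Unique (inOneBlock f same K3) rainbow))
        where
          same : ∀ i j → block (f i) ≡ block (f j)
          same = constantVia 0F λ { 0F → refl ; 1F → sym e01 ; 2F → sym (trans e01 e12) }
      byBlocks (yes e01) (no n12) _ =
        c12≢c02 (trans (blown-sym _ _) (trans (blown-shared (sym e01) (n12 ∘ sym)) (blown-sym _ _)))
      byBlocks (no n01) (yes e12) _ = c01≢c02 (blown-shared e12 n01)
      byBlocks (no n01) (no n12) (yes e02) =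
        c01≢c12 (trans (blown-sym _ _) (blown-shared e02 (n01 ∘ sym)))
      byBlocks (no n01) (no n12) (no n02) =
        Good.noRainbowTriangle outer (block ∘ f) (distinct⇒injective (block ∘ f) n01 n12 n02)
          (Unique.map⁻ {f = _↑ˡ k} (subst Unique (acrossBlocks f n01 n12 n02) rainbow))

  outerEdge : ∀ {p q i} → blown p q ≡ i ↑ˡ k → block p ≢ block q × oc (block p) (block q) ≡ i
  outerEdge {p} {q} e with block p ≟ᴼ block q
  ... | yes _ = ⊥-elim (↑ˡ≢↑ʳ r _ _ (sym e))
  ... | no apart = apart , ↑ˡ-injective k _ _ e

  innerEdge : ∀ {p q j} → blown p q ≡ r ↑ʳ j → block p ≡ block q × c (point p) (point q) ≡ j
  innerEdge {p} {q} e with block p ≟ᴼ block q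
  ... | yes same = same , ↑ʳ-injective r _ _ e
  ... | no _ = ⊥-elim (↑ˡ≢↑ʳ r _ _ e)

  -- A triangle in an outer colour meets three blocks, giving a monochromatic outer triangle.
  noOuterMonoTriangle : ∀ (g : Fin 3 → O × V) i → ¬ Mono blown g K3 (i ↑ˡ k)
  noOuterMonoTriangle g i (e01 ∷ e12 ∷ e02 ∷ [])
    with n01 , o01 ← outerEdge e01 | n12 , o12 ← outerEdge e12 | n02 , o02 ← outerEdge e02 =
    Good.noMonoCopy outer (block ∘ g) (distinct⇒injective (block ∘ g) n01 n12 n02) i (o01 ∷ o12 ∷ o02 ∷ [])

  -- A copy of H in an inner colour stays in one block, as H is connected.
  noInnerMonoCopy : ∀ (f : Fin m → O × V) → Injective _≡_ _≡_ f → ∀ j → ¬ Mono blown f H (r ↑ʳ j)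
  noInnerMonoCopy f f-inj j mono =
    Good.noMonoCopy inner (point ∘ f) (pointsInjective f same f-inj) j (All.map⁺ (All.map proj₂ edges))
    where
      edges : All (λ e → block (f (proj₁ e)) ≡ block (f (proj₂ e))
                         × c (point (f (proj₁ e))) (point (f (proj₂ e))) ≡ j) H
      edges = All.map innerEdge (All.map⁻ mono)
      same : ∀ i i' → block (f i) ≡ block (f i')
      same = H-connected (block ∘ f) (All.map proj₁ edges)

  noMono : ∀ (f : Fin m → O × V) → Injective _≡_ _≡_ f → ∀ x → ¬ Mono blown f H x
  noMono f f-inj x mono with palette r x
  ... | outerColour i = noOuterMonoTriangle (f ∘ proj₁ K3⊆H) i (mono-⊆ {f = f} blown-sym K3⊆H mono)
  ... | innerColour j = noInnerMonoCopy f f-inj j mono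

  good : Good (r + k) (O × V) H
  good = record { colour = blown ; symmetric = blown-sym ; noRainbowTriangle = noRainbow ; noMonoCopy = noMono }

Blocks : ℕ → Set → Set
Blocks zero V = V
Blocks (suc n) V = Fin 5 × Blocks n V

blowUps : ∀ {k m} {V : Set} {H : Graph m} → Connected H → K3 ⊆ H →
  ∀ n → Good k V H → Good (n * 2 + k) (Blocks n V) H
blowUps conn K3⊆H zero G = G
blowUps conn K3⊆H (suc n) G = Substitution.good _≟_ pentagonGood (blowUps conn K3⊆H n G) conn K3⊆H

blocks↣ : ∀ {b} {V : Set} n → Fin b ↣ V → Fin (5 ^ n * b) ↣ Blocks n V
blocks↣ {b} {V} zero ι = subst (λ s → Fin s ↣ V) (sym (*-identityˡ b)) ι
blocks↣ {b} {V} (suc n) ι =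
  subst (λ s → Fin s ↣ Blocks (suc n) V) (sym (*-assoc 5 (5 ^ n) b)) ((↣-id (Fin 5) ×-↣ blocks↣ n ι) ↣-∘ ↔⇒↣ *↔×)

halve : ∀ n → ∃ λ h → n ≡ h * 2 ⊎ n ≡ suc (h * 2)
halve zero = 0 , inj₁ refl
halve (suc n) with halve n
... | h , inj₁ even = h , inj₂ (cong suc even)
... | h , inj₂ odd = suc h , inj₁ (cong suc odd)

halves : ∀ h → h * 2 / 2 ≡ h
halves h = m*n/n≡m h 2

odd%2 : ∀ h → suc (h * 2) % 2 ≡ 1
odd%2 h = [m+kn]%n≡m%n 1 h 2

even%2 : ∀ h → suc (suc (h * 2)) % 2 ≡ 0
even%2 h = [m+kn]%n≡m%n 2 h 2

grBound-odd : ∀ h → grBound (suc (h * 2)) ≡ 5 ^ h * 4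
grBound-odd h rewrite odd%2 h | halves h = *-comm 4 (5 ^ h)

grBound-even : ∀ h → grBound (suc (suc (h * 2))) ≡ 5 ^ h * 9
grBound-even h rewrite even%2 h | halves h = *-comm 9 (5 ^ h)

oddCase : ∀ {H : Graph 5} → Connected H → K3 ⊆ H →
  ∀ h → GRGreater (suc (h * 2)) K3 H (grBound (suc (h * 2)))
oddCase {H} conn K3⊆H h =
  subst₂ (λ k B → GRGreater k K3 H B) (+-comm (h * 2) 1) (sym (grBound-odd h))
    (good⇒GRGreater (blowUps conn K3⊆H h (tooFewVertices (n<1+n 4))) (blocks↣ h (↣-id (Fin 4))))

evenCase : ∀ {H : Graph 5} → Connected H → Diamond ⊆ H →
  ∀ h → GRGreater (suc (suc (h * 2))) K3 H (grBound (suc (suc (h * 2))))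
evenCase {H} conn D⊆H h =
  subst₂ (λ k B → GRGreater k K3 H B) (+-comm (h * 2) 2) (sym (grBound-even h))
    (good⇒GRGreater (blowUps conn (⊆-trans K3⊆Diamond D⊆H) h (rookGood D⊆H)) (blocks↣ h (↔⇒↣ *↔×)))

grBound-lower : ∀ {H : Graph 5} → Connected H → Diamond ⊆ H → ∀ k → 1 ≤ k → GRGreater k K3 H (grBound k)
grBound-lower conn D⊆H (suc n) _ with halve n
... | h , inj₁ refl = oddCase conn (⊆-trans K3⊆Diamond D⊆H) h
... | h , inj₂ refl = evenCase conn D⊆H h

lemma4p2 : (k : ℕ) → 1 ≤ k → (H : Graph 5) → H ≡ F12 ⊎ H ≡ F13 →
    GRGreater k K3 H (grBound k)
lemma4p2 k 1≤k H (inj₁ refl) = grBound-lower F12-connected Diamond⊆F12 k 1≤k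
lemma4p2 k 1≤k H (inj₂ refl) = grBound-lower F13-connected Diamond⊆F13 k 1≤k
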